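{- Let $B\colon\mathcal{C}\to\mathcal{C}$ be an endofunctor and let $(T,\tau)$ be the companion of $B$ (so $T\colon\mathcal{C}\to\mathcal{C}$ and $\tau\colon TB\Rightarrow BT$). Then there are unique natural transformations $\eta\colon \mathrm{Id}\Rightarrow T$ and $\mu\colon TT\Rightarrow T$ such that $(T,\eta,\mu)$ is a monad and $\tau$ is a distributive law of this monad over $B$, i.e. $B\eta=\tau\circ\eta B$ and $\tau\circ\mu B=B\mu\circ\tau T\circ T\tau$.
   Context: For an endofunctor $B$, the category $\mathrm{DL}(B)$ has as objects pairs $(F,\lambda)$ with $F\colon\mathcal{C}\to\mathcal{C}$ a functor and $\lambda\colon FB\Rightarrow BF$ a natural transformation; a morphism $(F,\lambda)\to(G,\rho)$ is a natural transformation $\kappa\colon F\Rightarrow G$ with $\rho\circ\kappa B=B\kappa\circ\lambda$. The companion of $B$ is a final object of $\mathrm{DL}(B)$ (assumed to exist here). -}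

module Defs where

open import Level using (Level; _⊔_; suc)
open import Relation.Binary using (IsEquivalence)
open import Data.Product using (Σ; _×_; _,_)

record Category (o ℓ e : Level) : Set (suc (o ⊔ ℓ ⊔ e)) where
  infixr 9 _∘_
  infix 4 _≈_
  field
    Obj   : Set o
    Hom   : Obj → Obj → Set ℓ
    _≈_   : ∀ {A B} → Hom A B → Hom A B → Set e
    id    : ∀ {A} → Hom A A
    _∘_   : ∀ {A B C} → Hom B C → Hom A B → Hom A C
    ≈-equiv : ∀ {A B} → IsEquivalence (_≈_ {A} {B})
    ∘-resp-≈ : ∀ {A B C} {f h : Hom B C} {g i : Hom A B} → f ≈ h → g ≈ i → f ∘ g ≈ h ∘ i
    identityˡ : ∀ {A B} {f : Hom A B} → id ∘ f ≈ f
    identityʳ : ∀ {A B} {f : Hom A B} → f ∘ id ≈ f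
    assoc : ∀ {A B C D} {f : Hom A B} {g : Hom B C} {h : Hom C D} →
            (h ∘ g) ∘ f ≈ h ∘ (g ∘ f)

module _ {o ℓ e : Level} (C : Category o ℓ e) where
  open Category C

  record Endofunctor : Set (o ⊔ ℓ ⊔ e) where
    field
      F₀ : Obj → Obj
      F₁ : ∀ {A B} → Hom A B → Hom (F₀ A) (F₀ B)
      identity : ∀ {A} → F₁ (id {A}) ≈ id
      homomorphism : ∀ {A B C} {f : Hom A B} {g : Hom B C} → F₁ (g ∘ f) ≈ F₁ g ∘ F₁ f
      F-resp-≈ : ∀ {A B} {f g : Hom A B} → f ≈ g → F₁ f ≈ F₁ g

  open Endofunctor

  Id : Endofunctor
  Id = record
    { F₀ = λ X → X ; F₁ = λ f → f
    ; identity = IsEquivalence.refl ≈-equiv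
    ; homomorphism = IsEquivalence.refl ≈-equiv
    ; F-resp-≈ = λ p → p }

  _⊚_ : Endofunctor → Endofunctor → Endofunctor
  F ⊚ G = record
    { F₀ = λ X → F₀ F (F₀ G X)
    ; F₁ = λ f → F₁ F (F₁ G f)
    ; identity = IsEquivalence.trans ≈-equiv (F-resp-≈ F (identity G)) (identity F)
    ; homomorphism = IsEquivalence.trans ≈-equiv (F-resp-≈ F (homomorphism G)) (homomorphism F)
    ; F-resp-≈ = λ p → F-resp-≈ F (F-resp-≈ G p) }

  record NatTrans (F G : Endofunctor) : Set (o ⊔ ℓ ⊔ e) where
    field
      η : ∀ X → Hom (F₀ F X) (F₀ G X)
      commute : ∀ {X Y} (f : Hom X Y) → η Y ∘ F₁ F f ≈ F₁ G f ∘ η X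

  open NatTrans

  _≈N_ : ∀ {F G} → NatTrans F G → NatTrans F G → Set (o ⊔ e)
  α ≈N β = ∀ X → η α X ≈ η β X

  module _ (B : Endofunctor) where

    record DLObj : Set (o ⊔ ℓ ⊔ e) where
      constructor _,,_
      field
        fun : Endofunctor
        law : NatTrans (fun ⊚ B) (B ⊚ fun)

    open DLObj

    DLHom : DLObj → DLObj → Set (o ⊔ ℓ ⊔ e)
    DLHom X Y = Σ (NatTrans (fun X) (fun Y)) λ κ →
      ∀ A → η (law Y) A ∘ η κ (F₀ B A) ≈ F₁ B (η κ A) ∘ η (law X) A

    -- (T , τ) is a final object of DL(B) (i.e. a companion of B);
    -- morphisms of DL(B) are equal when their underlying natural
    -- transformations are componentwise equal.
    record IsCompanion (T : Endofunctor) (τ : NatTrans (T ⊚ B) (B ⊚ T)) : Set (suc (o ⊔ ℓ ⊔ e)) where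
      field
        ! : ∀ (X : DLObj) → DLHom X (T ,, τ)
        !-unique : ∀ (X : DLObj) (f g : DLHom X (T ,, τ)) → Σ.proj₁ f ≈N Σ.proj₁ g

  IsMonad : (T : Endofunctor) → NatTrans Id T → NatTrans (T ⊚ T) T → Set (o ⊔ e)
  IsMonad T ηT μT =
      (∀ X → η μT X ∘ F₁ T (η ηT X) ≈ id)
    × (∀ X → η μT X ∘ η ηT (F₀ T X) ≈ id)
    × (∀ X → η μT X ∘ F₁ T (η μT X) ≈ η μT X ∘ η μT (F₀ T X))

  IsDistributiveLaw : (B T : Endofunctor) → NatTrans (T ⊚ B) (B ⊚ T) →
                      NatTrans Id T → NatTrans (T ⊚ T) T → Set (o ⊔ e)
  IsDistributiveLaw B T τ ηT μT =
      (∀ X → F₁ B (η ηT X) ≈ η τ X ∘ η ηT (F₀ B X))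
    × (∀ X → η τ X ∘ η μT (F₀ B X) ≈ F₁ B (η μT X) ∘ (η τ (F₀ T X) ∘ F₁ T (η τ X)))

module Submission where

-- The companion is a monoid in the monoidal category DL(B).
--
-- DL(B) carries a monoidal structure:
--   (F , λ) ⊗ (G , ρ) = (FG , λG ∘ Fρ)   with unit   I = (Id , id),
-- and DL-morphisms can be whiskered on either side.  Unitors and
-- associator are DL-morphisms whose components are identities.
-- For the companion 𝕋 = (T , τ), finality gives the unit η = !(I) and the
-- multiplication μ = !(𝕋 ⊗ 𝕋); being DL-morphisms, they satisfy exactly the
-- two distributive-law equations.  Each monad law compares two
-- DL-morphisms out of 𝕋 ⊗ I, I ⊗ 𝕋 or 𝕋 ⊗ (𝕋 ⊗ 𝕋) into 𝕋 (built from η, μ,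
-- whiskering, composition and the structural isomorphisms), so it holds
-- because such morphisms are unique.  Conversely, any (η′ , μ′) making τ a
-- distributive law are DL-morphisms I → 𝕋 and 𝕋 ⊗ 𝕋 → 𝕋, hence agree with
-- η and μ.

open import Defs
open import Level using (Level; _⊔_)
open import Data.Product using (Σ; _×_; _,_; proj₁; proj₂)
open import Relation.Binary using (IsEquivalence; Setoid)
import Relation.Binary.Reasoning.Setoid as SetoidReasoning

module CategoryReasoning {o ℓ e : Level} (C : Category o ℓ e) where
  open Category C
  open Endofunctor

  module ≈ {A B : Obj} = IsEquivalence (≈-equiv {A} {B})

  hom-setoid : Obj → Obj → Setoid ℓ e
  hom-setoid A B = record { Carrier = Hom A B ; _≈_ = _≈_ ; isEquivalence = ≈-equiv }

  module HomReasoning {A B : Obj} = SetoidReasoning (hom-setoid A B)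

  refl⟩∘⟨_ : ∀ {A B D} {f : Hom B D} {g h : Hom A B} → g ≈ h → f ∘ g ≈ f ∘ h
  refl⟩∘⟨ p = ∘-resp-≈ ≈.refl p

  _⟩∘⟨refl : ∀ {A B D} {f g : Hom B D} {h : Hom A B} → f ≈ g → f ∘ h ≈ g ∘ h
  p ⟩∘⟨refl = ∘-resp-≈ p ≈.refl

  id-comm : ∀ {A B} {f : Hom A B} → id ∘ f ≈ f ∘ id
  id-comm = ≈.trans identityˡ (≈.sym identityʳ)

  paste-horizontal : ∀ {A₁ A₂ A₃ A₄ A₅ A₆} {f : Hom A₁ A₂} {α : Hom A₂ A₃} {β : Hom A₃ A₄}
    {g : Hom A₅ A₃} {h : Hom A₆ A₄} {α′ : Hom A₁ A₅} {β′ : Hom A₅ A₆} →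
    α ∘ f ≈ g ∘ α′ → β ∘ g ≈ h ∘ β′ → (β ∘ α) ∘ f ≈ h ∘ (β′ ∘ α′)
  paste-horizontal {f = f} {α} {β} {g} {h} {α′} {β′} sq₁ sq₂ = begin
    (β ∘ α) ∘ f   ≈⟨ assoc ⟩
    β ∘ (α ∘ f)   ≈⟨ refl⟩∘⟨ sq₁ ⟩
    β ∘ (g ∘ α′)  ≈⟨ ≈.sym assoc ⟩
    (β ∘ g) ∘ α′  ≈⟨ sq₂ ⟩∘⟨refl ⟩
    (h ∘ β′) ∘ α′ ≈⟨ assoc ⟩
    h ∘ (β′ ∘ α′) ∎
    where open HomReasoning

  paste-vertical : ∀ {A₁ A₂ A₃ A₄ A₅ A₆} {c : Hom A₁ A₂} {b : Hom A₂ A₃} {a : Hom A₃ A₄}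
    {a′ : Hom A₂ A₅} {b′ : Hom A₅ A₄} {a″ : Hom A₁ A₆} {c′ : Hom A₆ A₅} →
    a ∘ b ≈ b′ ∘ a′ → a′ ∘ c ≈ c′ ∘ a″ → a ∘ (b ∘ c) ≈ (b′ ∘ c′) ∘ a″
  paste-vertical {c = c} {b} {a} {a′} {b′} {a″} {c′} sq₁ sq₂ = begin
    a ∘ (b ∘ c)    ≈⟨ ≈.sym assoc ⟩
    (a ∘ b) ∘ c    ≈⟨ sq₁ ⟩∘⟨refl ⟩
    (b′ ∘ a′) ∘ c  ≈⟨ assoc ⟩
    b′ ∘ (a′ ∘ c)  ≈⟨ refl⟩∘⟨ sq₂ ⟩
    b′ ∘ (c′ ∘ a″) ≈⟨ ≈.sym assoc ⟩
    (b′ ∘ c′) ∘ a″ ∎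
    where open HomReasoning

  F-square : ∀ (F : Endofunctor C) {A B D E} {f : Hom B D} {g : Hom A B} {h : Hom E D} {k : Hom A E} →
    f ∘ g ≈ h ∘ k → F₁ F f ∘ F₁ F g ≈ F₁ F h ∘ F₁ F k
  F-square F sq = ≈.trans (≈.sym (homomorphism F)) (≈.trans (F-resp-≈ F sq) (homomorphism F))

module MonoidalDL {o ℓ e : Level} (C : Category o ℓ e) (B : Endofunctor C) where
  open Category C
  open CategoryReasoning C
  open Endofunctor
  open NatTrans
  open DLObj

  infixr 9 _⊙_ _∘D_
  infixr 7 _⊗_

  _⊙_ : Endofunctor C → Endofunctor C → Endofunctor C
  _⊙_ = _⊚_ C

  -- DL-morphisms as a record indexed by their endpoints, so that the
  -- endpoints can be inferred from a morphism (DLHom is a Σ-type, which is not).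
  record _⇒_ (X Y : DLObj C B) : Set (o ⊔ ℓ ⊔ e) where
    constructor ⌈_⌉
    field
      ⌊_⌋ : DLHom C B X Y
  open _⇒_ public

  _∘D_ : ∀ {X Y Z} → Y ⇒ Z → X ⇒ Y → X ⇒ Z
  _∘D_ {X} {Z = Z} ⌈ κ , κ-law ⌉ ⌈ ι , ι-law ⌉ = ⌈ composite , (λ A →
      ≈.trans (paste-vertical (κ-law A) (ι-law A)) (≈.sym (homomorphism B) ⟩∘⟨refl)) ⌉
    where
    composite : NatTrans C (fun X) (fun Z)
    composite = record
      { η = λ A → η κ A ∘ η ι A
      ; commute = λ f → paste-horizontal (commute ι f) (commute κ f) }

  -- The DL-morphism condition for a transformation with identity components
  -- reduces to equality of the two distributive laws.
  law-along-id : ∀ {A D} {f g : Hom A (F₀ B D)} → f ≈ g → f ∘ id ≈ F₁ B id ∘ g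
  law-along-id p = ≈.trans identityʳ (≈.trans p (≈.trans (≈.sym identityˡ) (≈.sym (identity B) ⟩∘⟨refl)))

  I : DLObj C B
  I = Id C ,, record { η = λ _ → id ; commute = λ _ → id-comm }

  _⊗_ : DLObj C B → DLObj C B → DLObj C B
  (F ,, λ′) ⊗ (G ,, ρ) = (F ⊙ G) ,, record
    { η = λ A → η λ′ (F₀ G A) ∘ F₁ F (η ρ A)
    ; commute = λ f → paste-horizontal (F-square F (commute ρ f)) (commute λ′ (F₁ G f)) }

  _◁_ : ∀ (X : DLObj C B) {Y Z} → Y ⇒ Z → (X ⊗ Y) ⇒ (X ⊗ Z)
  (F ,, λ′) ◁ ⌈ κ , κ-law ⌉ =
    ⌈ Fκ , (λ A → paste-horizontal (F-square F (κ-law A)) (commute λ′ (η κ A))) ⌉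
    where
    Fκ : NatTrans C _ _
    Fκ = record { η = λ A → F₁ F (η κ A) ; commute = λ f → F-square F (commute κ f) }

  _▷_ : ∀ {X Y} → X ⇒ Y → (Z : DLObj C B) → (X ⊗ Z) ⇒ (Y ⊗ Z)
  ⌈ κ , κ-law ⌉ ▷ (H ,, σ) =
    ⌈ κH , (λ A → paste-horizontal (≈.sym (commute κ (η σ A))) (κ-law (F₀ H A))) ⌉
    where
    κH : NatTrans C _ _
    κH = record { η = λ A → η κ (F₀ H A) ; commute = λ f → commute κ (F₁ H f) }

  unitorˡ : ∀ X → (I ⊗ X) ⇒ X
  unitorˡ X = ⌈ record { η = λ _ → id ; commute = λ _ → id-comm }
              , (λ A → law-along-id (≈.sym identityˡ)) ⌉

  unitorʳ : ∀ X → (X ⊗ I) ⇒ X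
  unitorʳ (F ,, λ′) = ⌈ record { η = λ _ → id ; commute = λ _ → id-comm }
                      , (λ A → law-along-id (≈.sym (≈.trans (refl⟩∘⟨ identity F) identityʳ))) ⌉

  associator : ∀ X Y Z → (X ⊗ (Y ⊗ Z)) ⇒ ((X ⊗ Y) ⊗ Z)
  associator (F ,, λ′) (G ,, ρ) (H ,, σ) = ⌈ record { η = λ _ → id ; commute = λ _ → id-comm }
    , (λ A → law-along-id (≈.trans assoc (refl⟩∘⟨ ≈.sym (homomorphism F)))) ⌉

module CompanionMonad {o ℓ e : Level} {C : Category o ℓ e} {B T : Endofunctor C}
    {τ : NatTrans C (_⊚_ C T B) (_⊚_ C B T)} (companion : IsCompanion C B T τ) where
  open Category C
  open CategoryReasoning C
  open MonoidalDL C B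
  open IsCompanion companion

  𝕋 : DLObj C B
  𝕋 = T ,, τ

  final : ∀ {X} (f g : X ⇒ 𝕋) → _≈N_ C (proj₁ ⌊ f ⌋) (proj₁ ⌊ g ⌋)
  final {X} f g = !-unique X ⌊ f ⌋ ⌊ g ⌋

  unitD : I ⇒ 𝕋
  unitD = ⌈ ! I ⌉

  multD : (𝕋 ⊗ 𝕋) ⇒ 𝕋
  multD = ⌈ ! (𝕋 ⊗ 𝕋) ⌉

  unit : NatTrans C (Id C) T
  unit = proj₁ ⌊ unitD ⌋

  mult : NatTrans C (T ⊙ T) T
  mult = proj₁ ⌊ multD ⌋

  -- Each monad law identifies two DL-morphisms into the final object 𝕋.
  monad : IsMonad C T unit mult
  monad = final (multD ∘D (𝕋 ◁ unitD)) (unitorʳ 𝕋)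
        , final (multD ∘D (unitD ▷ 𝕋)) (unitorˡ 𝕋)
        , λ A → ≈.trans (final (multD ∘D (𝕋 ◁ multD))
                               ((multD ∘D (multD ▷ 𝕋)) ∘D associator 𝕋 𝕋 𝕋) A)
                        identityʳ

  -- The distributive-law equations are the DL-morphism conditions of unit and mult.
  distributive : IsDistributiveLaw C B T τ unit mult
  distributive = (λ A → ≈.sym (≈.trans (proj₂ ⌊ unitD ⌋ A) identityʳ)) , proj₂ ⌊ multD ⌋

  -- A unit and multiplication making τ a distributive law are DL-morphisms, hence forced.
  unique : ∀ (η′ : NatTrans C (Id C) T) (μ′ : NatTrans C (T ⊙ T) T) →
           IsMonad C T η′ μ′ → IsDistributiveLaw C B T τ η′ μ′ →
           (_≈N_ C η′ unit × _≈N_ C μ′ mult)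
  unique η′ μ′ _ (unit-law , mult-law) =
      final ⌈ η′ , (λ A → ≈.trans (≈.sym (unit-law A)) (≈.sym identityʳ)) ⌉ unitD
    , final ⌈ μ′ , mult-law ⌉ multD

theorem4p2 : ∀ {o ℓ e : Level} (C : Category o ℓ e) (B T : Endofunctor C)
    (τ : NatTrans C (_⊚_ C T B) (_⊚_ C B T)) →
    IsCompanion C B T τ →
    Σ (NatTrans C (Id C) T) λ η → Σ (NatTrans C (_⊚_ C T T) T) λ μ →
    (IsMonad C T η μ × IsDistributiveLaw C B T τ η μ)
    × (∀ (η′ : NatTrans C (Id C) T) (μ′ : NatTrans C (_⊚_ C T T) T) →
    IsMonad C T η′ μ′ → IsDistributiveLaw C B T τ η′ μ′ →
    (_≈N_ C η′ η × _≈N_ C μ′ μ))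
theorem4p2 C B T τ companion = unit , mult , (monad , distributive) , unique
  where open CompanionMonad companion
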